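{- Let $n\ge 1$, $1\le m<2^{n/2}$ and $k\ge 1$ be integers with $m\ge 20nk$. Let $Q$ be a $\mathsf{PostBPP}$ list-solver for $\textsc{XOR-Missing-String}(n,m)$ that outputs $k$ candidate strings. If $Q$ list-solves $\textsc{XOR-Missing-String}(n,m)$ with error at most $2^{ -5nk}$, then the complexity of $Q$ is $\Omega(m)$. That is, there is an absolute constant $c>0$ such that its complexity is at least $cm$.
   Context: $\textsc{XOR-Missing-String}(n,m)$: Alice gets $X=(x_1,\dots,x_m)$ and Bob gets $Y=(y_1,\dots,y_m)$, with all strings in $\{0,1\}^n$. A string $s\in\{0,1\}^n$ is a solution if $s\ne x_i\oplus y_j$ for all $i,j$. A $\mathsf{PostBPP}$ communication protocol $\Pi$ is given by a length $k'$ and deterministic protocols $\{\Pi_r\}_{r\in\{0,1\}^{k'}}$, each of communication complexity $c$ and each outputting $\bot$ or a value. On input $(X,Y)$, it draws a uniform public $r$ and runs $\Pi_r$. Its complexity is $k'+c$. A list-solver outputs a list of $k$ candidate strings from $\{0,1\}^n$ (or $\bot$). It list-solves the problem with error $\epsilon$ if for every input $(X,Y)$, \[ \Pr_r[\text{some string in }\Pi_r(X,Y)\text{ is a solution to }(X,Y)\mid\Pi_r(X,Y)\ne\bot]\ge 1-\epsilon. \] -}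

module Defs where

open import Data.Nat using (ℕ; zero; suc; _+_)
open import Data.Bool using (Bool; true; false; _xor_)
import Data.Bool.Properties as BoolP
open import Data.Vec using (Vec; []; _∷_; zipWith)
open import Data.Vec.Properties using (≡-dec)
open import Data.Vec.Relation.Unary.Any using (Any; any?)
open import Data.Fin using (Fin)
open import Data.Fin.Properties using (all?)
open import Data.Maybe using (Maybe; just; nothing)
open import Data.Empty using (⊥)
open import Data.Unit using (⊤)
open import Data.Product using (_×_)
open import Relation.Nullary using (Dec; yes; no; ¬_; ¬?)
open import Relation.Unary using (Decidable)
open import Relation.Binary.PropositionalEquality using (_≡_; _≢_)

BitStr : ℕ → Set
BitStr n = Vec Bool n

_⊕_ : ∀ {n} → BitStr n → BitStr n → BitStr n
_⊕_ = zipWith _xor_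

Strings : ℕ → ℕ → Set
Strings n m = Fin m → BitStr n

IsSolution : ∀ {n m} → Strings n m → Strings n m → BitStr n → Set
IsSolution X Y s = ∀ i j → s ≢ (X i ⊕ Y j)

isSolution? : ∀ {n m} (X Y : Strings n m) → Decidable (IsSolution X Y)
isSolution? X Y s = all? (λ i → all? (λ j → ¬? (≡-dec BoolP._≟_ s (X i ⊕ Y j))))

-- Deterministic two-party protocol trees of communication complexity ≤ c:
-- Alice holds A, Bob holds B; each internal node is one bit sent by its owner.
data Protocol (A B O : Set) : ℕ → Set where
  leaf  : ∀ {c} → O → Protocol A B O c
  alice : ∀ {c} → (A → Bool) → (t f : Protocol A B O c) → Protocol A B O (suc c)
  bob   : ∀ {c} → (B → Bool) → (t f : Protocol A B O c) → Protocol A B O (suc c)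

run : ∀ {A B O c} → Protocol A B O c → A → B → O
run (leaf o)      a b = o
run (alice g t f) a b with g a
... | true  = run t a b
... | false = run f a b
run (bob g t f)   a b with g b
... | true  = run t a b
... | false = run f a b

count : (k : ℕ) (P : BitStr k → Set) → Decidable P → ℕ
count zero    P P? with P? []
... | yes _ = 1
... | no  _ = 0
count (suc k) P P? =
  count k (λ r → P (true ∷ r)) (λ r → P? (true ∷ r))
  + count k (λ r → P (false ∷ r)) (λ r → P? (false ∷ r))

-- A PostBPP list-solver for XOR-Missing-String(n,m) outputting k candidates
-- (output nothing = ⊥).
record PostBPPListSolver (n m k : ℕ) : Set where
  field
    seedLen : ℕ
    commLen : ℕ
    Π : BitStr seedLen →
        Protocol (Strings n m) (Strings n m) (Maybe (Vec (BitStr n) k)) commLen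

  complexity : ℕ
  complexity = seedLen + commLen

Accepted : ∀ {n k} → Maybe (Vec (BitStr n) k) → Set
Accepted nothing  = ⊥
Accepted (just _) = ⊤

accepted? : ∀ {n k} → Decidable (Accepted {n} {k})
accepted? nothing  = no (λ ())
accepted? (just _) = yes _

Succeeds : ∀ {n m k} → Strings n m → Strings n m → Maybe (Vec (BitStr n) k) → Set
Succeeds X Y nothing  = ⊥
Succeeds X Y (just L) = Any (IsSolution X Y) L

succeeds? : ∀ {n m k} (X Y : Strings n m) → Decidable (Succeeds {n} {m} {k} X Y)
succeeds? X Y nothing  = no (λ ())
succeeds? X Y (just L) = any? (isSolution? X Y) L

module _ {n m k : ℕ} (Q : PostBPPListSolver n m k) (X Y : Strings n m) where
  open PostBPPListSolver Q

  acceptCount : ℕ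
  acceptCount = count seedLen (λ r → Accepted (run (Π r) X Y))
                              (λ r → accepted? (run (Π r) X Y))

  successCount : ℕ
  successCount = count seedLen (λ r → Succeeds X Y (run (Π r) X Y))
                               (λ r → succeeds? X Y (run (Π r) X Y))

-- Q list-solves with error at most a/b:
-- for all inputs, Pr[≠⊥] > 0 and Pr[success | ≠⊥] ≥ 1 - a/b,
-- i.e. b·#success + a·#accept ≥ b·#accept.
open import Data.Nat using (_<_; _≤_; _*_)

ListSolves : ∀ {n m k} → PostBPPListSolver n m k → (a b : ℕ) → Set
ListSolves {n} {m} Q a b = (X Y : Strings n m) →
  (0 < acceptCount Q X Y) ×
  (b * acceptCount Q X Y ≤ b * successCount Q X Y + a * acceptCount Q X Y)

-- A deterministic protocol with c bits of communication partitions the inputs into at most 2^c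
-- rectangles A × B.  Call u heavy for A at coordinate i when at least a 1/N² fraction of A
-- (N = 2^n) has X i = u.  At most half of A uses a light value somewhere (this is where 2m ≤ N
-- enters), and the rest lies in the product set of strings that are heavy at every coordinate
-- with more than N/2 heavy values; so |A| · 2^t ≤ 2N^m, where t counts the coordinates with at
-- most N/2 heavy values.  Hence in a rectangle with |A| |B| 2^m > (2N^m)² some coordinate i has
-- more than N/2 heavy values for A and for B, and for every candidate s some u is heavy for A
-- while u ⊕ s is heavy for B.  On the subrectangle X i = u, Y i = u ⊕ s, at most N⁴ times
-- smaller, s = X i ⊕ Y i is never a solution.  Iterating over the k candidates, any list fails on
-- at least a 1/N^(4k) fraction of every large rectangle.  As the solver fails with conditional
-- probability at most 2^(-5nk) ≤ 1/(2N^(4k)), at most half of its acceptance mass lies in large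
-- leaf rectangles; the small ones have total mass at most 2^(k'+c) · 2^(-m) · (2N^m)² N^(4k) over
-- all seeds and leaves, while every input is accepted by some seed.  So m ≤ k' + c + 3 + 4nk,
-- and m ≤ 5 (k' + c) once 20nk ≤ m.

{-# OPTIONS --safe #-}
module Submission where

open import Data.Bool using (Bool; true; false; _∧_; _∨_; not; T; if_then_else_)
open import Data.Bool.Properties using (not-involutive; T-≡; T-∧) renaming (_≟_ to _≟ᵇ_)
open import Data.Empty using (⊥-elim)
open import Data.Fin using (Fin; zero; suc)
open import Data.Fin.Properties using (¬∀⟶∃¬)
open import Data.Maybe using (Maybe; just; nothing)
open import Data.Nat using (ℕ; zero; suc; NonZero; _+_; _*_; _∸_; _^_; _≤_; _<_; z≤n; s≤s; _≤?_; _<?_)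
open import Data.Nat.Properties hiding (_≟_)
open import Data.Nat.Tactic.RingSolver using (solve-∀)
open import Data.Product using (Σ; _×_; _,_; ∃; ∃₂; proj₁; proj₂)
open import Data.Vec using (Vec; []; _∷_)
import Data.Vec.Functional as Vector
open import Data.Vec.Properties using (≡-dec)
open import Data.Vec.Relation.Unary.Any using (Any; here; there; any?)
open import Function.Base using (_∘_)
open import Function.Bundles using (mk⇔; Equivalence)
open import Relation.Binary.PropositionalEquality
open import Relation.Nullary using (¬_; Dec; yes; no; does)
open import Relation.Nullary.Decidable using (⌊_⌋; T?; toWitness; fromWitness; does-⇔)
open import Relation.Unary using (Decidable)

open import Algebra.Properties.CommutativeMonoid.Sum +-0-commutativeMonoid
  using (sum; sum-syntax; sum-cong-≗; ∑-distrib-+)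
open import Algebra.Properties.CommutativeSemigroup +-commutativeSemigroup
  using () renaming (interchange to +-interchange)
open import Algebra.Properties.CommutativeSemigroup *-commutativeSemigroup
  using () renaming (interchange to *-interchange)

open import Defs

𝟙 : Bool → ℕ
𝟙 true  = 1
𝟙 false = 0

𝟙≤1 : ∀ b → 𝟙 b ≤ 1
𝟙≤1 true  = ≤-refl
𝟙≤1 false = z≤n

𝟙-∧ : ∀ a b → 𝟙 (a ∧ b) ≡ 𝟙 a * 𝟙 b
𝟙-∧ true  b = sym (*-identityˡ (𝟙 b))
𝟙-∧ false b = refl

𝟙-not : ∀ b → 𝟙 b + 𝟙 (not b) ≡ 1
𝟙-not true  = refl
𝟙-not false = refl

𝟙-if : ∀ a b p q → 𝟙 a * (if b then p else q) ≡ 𝟙 (a ∧ b) * p + 𝟙 (a ∧ not b) * q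
𝟙-if true  true  p q = sym (+-identityʳ (1 * p))
𝟙-if true  false p q = refl
𝟙-if false b     p q = refl

1<𝟙+𝟙⇒T×T : ∀ a b → 1 < 𝟙 a + 𝟙 b → T a × T b
1<𝟙+𝟙⇒T×T true  true  _ = _ , _
1<𝟙+𝟙⇒T×T true  false (s≤s ())
1<𝟙+𝟙⇒T×T false true  (s≤s ())

T-does⇒ : ∀ {P : Set} (P? : Dec P) → T (does P?) → P
T-does⇒ (yes p) _ = p

-- Finite sums

record IsSummation {A : Set} (∑ : (A → ℕ) → ℕ) : Set where
  field
    cong-≗    : ∀ {f g} → f ≗ g → ∑ f ≡ ∑ g
    distrib-+ : ∀ f g → ∑ (λ x → f x + g x) ≡ ∑ f + ∑ g

  zero-sum : ∑ (λ _ → 0) ≡ 0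
  zero-sum = +-cancelˡ-≡ s s 0 (trans (sym (distrib-+ (λ _ → 0) (λ _ → 0))) (sym (+-identityʳ s)))
    where s = ∑ (λ _ → 0)

  *-distribˡ : ∀ c f → ∑ (λ x → c * f x) ≡ c * ∑ f
  *-distribˡ zero    f = zero-sum
  *-distribˡ (suc c) f = trans (distrib-+ f _) (cong (∑ f +_) (*-distribˡ c f))

  *-distribʳ : ∀ c f → ∑ (λ x → f x * c) ≡ ∑ f * c
  *-distribʳ c f = trans (cong-≗ (λ x → *-comm (f x) c)) (trans (*-distribˡ c f) (*-comm c (∑ f)))

  const : ∀ c → ∑ (λ _ → c) ≡ c * ∑ (λ _ → 1)
  const c = trans (cong-≗ (λ _ → sym (*-identityʳ c))) (*-distribˡ c (λ _ → 1))

  mono-≤ : ∀ {f g} → (∀ x → f x ≤ g x) → ∑ f ≤ ∑ g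
  mono-≤ {f} {g} f≤g = begin
    ∑ f                               ≤⟨ m≤m+n (∑ f) _ ⟩
    ∑ f + ∑ (λ x → g x ∸ f x)         ≡⟨ distrib-+ f _ ⟨
    ∑ (λ x → f x + (g x ∸ f x))       ≡⟨ cong-≗ (λ x → m+[n∸m]≡n (f≤g x)) ⟩
    ∑ g                               ∎
    where open ≤-Reasoning

  indicator≤ : ∀ (a : A → Bool) → ∑ (λ x → 𝟙 (a x)) ≤ ∑ (λ _ → 1)
  indicator≤ a = mono-≤ (λ x → 𝟙≤1 (a x))

sumBits : ∀ n → (BitStr n → ℕ) → ℕ
sumBits zero    f = f []
sumBits (suc n) f = sumBits n (λ v → f (true ∷ v)) + sumBits n (λ v → f (false ∷ v))

sumBits-isSummation : ∀ n → IsSummation (sumBits n)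
sumBits-isSummation n = record { cong-≗ = cong-≗ n ; distrib-+ = distrib-+ n }
  where
  cong-≗ : ∀ n {f g} → f ≗ g → sumBits n f ≡ sumBits n g
  cong-≗ zero    f≗g = f≗g []
  cong-≗ (suc n) f≗g = cong₂ _+_ (cong-≗ n (f≗g ∘ (true ∷_))) (cong-≗ n (f≗g ∘ (false ∷_)))

  distrib-+ : ∀ n f g → sumBits n (λ x → f x + g x) ≡ sumBits n f + sumBits n g
  distrib-+ zero    f g = refl
  distrib-+ (suc n) f g = trans
    (cong₂ _+_ (distrib-+ n (f ∘ (true ∷_)) (g ∘ (true ∷_)))
               (distrib-+ n (f ∘ (false ∷_)) (g ∘ (false ∷_))))
    (+-interchange (sumBits n (f ∘ (true ∷_))) _ (sumBits n (f ∘ (false ∷_))) _)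

module SumBits (n : ℕ) = IsSummation (sumBits-isSummation n)

sumBits-1 : ∀ n → sumBits n (λ _ → 1) ≡ 2 ^ n
sumBits-1 zero    = refl
sumBits-1 (suc n) = trans (cong₂ _+_ (sumBits-1 n) (sumBits-1 n)) (cong (2 ^ n +_) (sym (+-identityʳ (2 ^ n))))

sumBits-comm : ∀ n {A} {∑ : (A → ℕ) → ℕ} → IsSummation ∑ → (f : BitStr n → A → ℕ) →
  sumBits n (λ x → ∑ (f x)) ≡ ∑ (λ y → sumBits n (λ x → f x y))
sumBits-comm zero    ∑-isSummation f = refl
sumBits-comm (suc n) ∑-isSummation f = trans
  (cong₂ _+_ (sumBits-comm n ∑-isSummation (f ∘ (true ∷_))) (sumBits-comm n ∑-isSummation (f ∘ (false ∷_))))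
  (sym (IsSummation.distrib-+ ∑-isSummation _ _))

sumBits-⊕ : ∀ n f (s : BitStr n) → sumBits n (λ u → f (u ⊕ s)) ≡ sumBits n f
sumBits-⊕ zero    f []          = refl
sumBits-⊕ (suc n) f (true ∷ s)  = trans
  (cong₂ _+_ (sumBits-⊕ n (f ∘ (false ∷_)) s) (sumBits-⊕ n (f ∘ (true ∷_)) s))
  (+-comm (sumBits n (f ∘ (false ∷_))) _)
sumBits-⊕ (suc n) f (false ∷ s) =
  cong₂ _+_ (sumBits-⊕ n (f ∘ (true ∷_)) s) (sumBits-⊕ n (f ∘ (false ∷_)) s)

infix 4 _≟_
_≟_ : ∀ {n} (v w : BitStr n) → Dec (v ≡ w)
_≟_ = ≡-dec _≟ᵇ_

⊕-cancelˡ : ∀ {n} (u s : BitStr n) → u ⊕ (u ⊕ s) ≡ s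
⊕-cancelˡ []          []      = refl
⊕-cancelˡ (true  ∷ u) (b ∷ s) = cong₂ _∷_ (not-involutive b) (⊕-cancelˡ u s)
⊕-cancelˡ (false ∷ u) (b ∷ s) = cong (b ∷_) (⊕-cancelˡ u s)

sumBits-δ : ∀ n (h : BitStr n → ℕ) w → sumBits n (λ u → 𝟙 (does (w ≟ u)) * h u) ≡ h w
sumBits-δ zero    h []          = *-identityˡ (h [])
sumBits-δ (suc n) h (true ∷ w)  = trans
  (cong₂ _+_ (sumBits-δ n (h ∘ (true ∷_)) w) (SumBits.zero-sum n))
  (+-identityʳ _)
sumBits-δ (suc n) h (false ∷ w) = cong₂ _+_ (SumBits.zero-sum n) (sumBits-δ n (h ∘ (false ∷_)) w)

sumBits-<⇒∃< : ∀ n f g → sumBits n f < sumBits n g → ∃ λ x → f x < g x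
sumBits-<⇒∃< zero    f g f<g = [] , f<g
sumBits-<⇒∃< (suc n) f g f<g
  with sumBits n (f ∘ (true ∷_)) <? sumBits n (g ∘ (true ∷_))
... | yes f₁<g₁ = let x , fx<gx = sumBits-<⇒∃< n _ _ f₁<g₁ in true ∷ x , fx<gx
... | no  f₁≮g₁ = let x , fx<gx = sumBits-<⇒∃< n _ _ f₀<g₀ in false ∷ x , fx<gx
  where
  f₀<g₀ : sumBits n (f ∘ (false ∷_)) < sumBits n (g ∘ (false ∷_))
  f₀<g₀ = +-cancelˡ-< _ _ _ (<-≤-trans f<g (+-monoˡ-≤ _ (≮⇒≥ f₁≮g₁)))

count≡sumBits : ∀ k P (P? : Decidable P) → count k P P? ≡ sumBits k (λ r → 𝟙 (does (P? r)))
count≡sumBits zero    P P? with P? []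
... | yes _ = refl
... | no  _ = refl
count≡sumBits (suc k) P P? =
  cong₂ _+_ (count≡sumBits k _ (P? ∘ (true ∷_))) (count≡sumBits k _ (P? ∘ (false ∷_)))

sumFin-isSummation : ∀ m → IsSummation (sum {m})
sumFin-isSummation m = record { cong-≗ = sum-cong-≗ ; distrib-+ = ∑-distrib-+ }

module SumFin (m : ℕ) = IsSummation (sumFin-isSummation m)

all : ∀ {m} → (Fin m → Bool) → Bool
all = Vector.foldr _∧_ true

product : ∀ {m} → (Fin m → ℕ) → ℕ
product = Vector.foldr _*_ 1

𝟙-all-cover : ∀ {m} (b : Fin m → Bool) → 1 ≤ 𝟙 (all b) + ∑[ i < m ] 𝟙 (not (b i))
𝟙-all-cover {zero}  b = ≤-refl
𝟙-all-cover {suc m} b with b zero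
... | true  = 𝟙-all-cover (b ∘ suc)
... | false = s≤s z≤n

sum-1 : ∀ m → ∑[ i < m ] 1 ≡ m
sum-1 zero    = refl
sum-1 (suc m) = cong suc (sum-1 m)

∃-neither : ∀ {m} (a b : Fin m → Bool) →
  ∑[ i < m ] 𝟙 (a i) + ∑[ i < m ] 𝟙 (b i) < m → ∃ λ i → ¬ T (a i) × ¬ T (b i)
∃-neither {m} a b count<m =
  let i , ¬aᵢ∨bᵢ = ¬∀⟶∃¬ m (λ i → T (a i ∨ b i)) (λ i → T? (a i ∨ b i)) not-covered
  in  i , ¬T-∨ (a i) (b i) ¬aᵢ∨bᵢ
  where
  ¬T-∨ : ∀ x y → ¬ T (x ∨ y) → ¬ T x × ¬ T y
  ¬T-∨ false false _  = (λ ()) , (λ ())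
  ¬T-∨ true  _     ¬t = ⊥-elim (¬t _)
  ¬T-∨ false true  ¬t = ⊥-elim (¬t _)

  T-∨⇒1≤𝟙+𝟙 : ∀ x y → T (x ∨ y) → 1 ≤ 𝟙 x + 𝟙 y
  T-∨⇒1≤𝟙+𝟙 true  _    _ = s≤s z≤n
  T-∨⇒1≤𝟙+𝟙 false true _ = s≤s z≤n

  not-covered : ¬ (∀ i → T (a i ∨ b i))
  not-covered covered = <⇒≱ count<m (begin
    m                                  ≡⟨ sum-1 m ⟨
    ∑[ i < m ] 1                       ≤⟨ SumFin.mono-≤ m (λ i → T-∨⇒1≤𝟙+𝟙 (a i) (b i) (covered i)) ⟩
    ∑[ i < m ] (𝟙 (a i) + 𝟙 (b i))     ≡⟨ ∑-distrib-+ (𝟙 ∘ a) (𝟙 ∘ b) ⟩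
    ∑[ i < m ] 𝟙 (a i) + ∑[ i < m ] 𝟙 (b i) ∎)
    where open ≤-Reasoning

product-bound : ∀ {m} N (a : Fin m → ℕ) (b : Fin m → Bool) → (∀ i → a i ≤ N) →
  (∀ i → T (b i) → 2 * a i ≤ N) → product a * 2 ^ (∑[ i < m ] 𝟙 (b i)) ≤ N ^ m
product-bound {zero}  N a b a≤N b⇒2a≤N = ≤-refl
product-bound {suc m} N a b a≤N b⇒2a≤N = step (b zero) (b⇒2a≤N zero)
  where
  open ≤-Reasoning
  P = product (a ∘ suc)
  R = ∑[ i < m ] 𝟙 (b (suc i))

  IH : P * 2 ^ R ≤ N ^ m
  IH = product-bound N (a ∘ suc) (b ∘ suc) (a≤N ∘ suc) (b⇒2a≤N ∘ suc)

  step : ∀ b₀ → (T b₀ → 2 * a zero ≤ N) → a zero * P * 2 ^ (𝟙 b₀ + R) ≤ N * N ^ m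
  step true  2a₀≤N = begin
    a zero * P * (2 * 2 ^ R)   ≡⟨ *-interchange (a zero) P 2 (2 ^ R) ⟩
    a zero * 2 * (P * 2 ^ R)   ≤⟨ *-mono-≤ (≤-trans (≤-reflexive (*-comm (a zero) 2)) (2a₀≤N _)) IH ⟩
    N * N ^ m                  ∎
  step false _     = begin
    a zero * P * 2 ^ R         ≡⟨ *-assoc (a zero) P _ ⟩
    a zero * (P * 2 ^ R)       ≤⟨ *-mono-≤ (a≤N zero) IH ⟩
    N * N ^ m                  ∎

sumStrings : ∀ {n} m → (Strings n m → ℕ) → ℕ
sumStrings {n} zero    f = f (λ ())
sumStrings {n} (suc m) f = sumBits n (λ v → sumStrings m (λ X → f (v Vector.∷ X)))

module _ {n : ℕ} where

  sumStrings-isSummation : ∀ m → IsSummation (sumStrings {n} m)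
  sumStrings-isSummation m = record { cong-≗ = cong-≗ m ; distrib-+ = distrib-+ m }
    where
    cong-≗ : ∀ m {f g : Strings n m → ℕ} → f ≗ g → sumStrings m f ≡ sumStrings m g
    cong-≗ zero    f≗g = f≗g (λ ())
    cong-≗ (suc m) f≗g = SumBits.cong-≗ n (λ v → cong-≗ m (λ X → f≗g (v Vector.∷ X)))

    distrib-+ : ∀ m (f g : Strings n m → ℕ) →
      sumStrings m (λ X → f X + g X) ≡ sumStrings m f + sumStrings m g
    distrib-+ zero    f g = refl
    distrib-+ (suc m) f g = trans
      (SumBits.cong-≗ n (λ v → distrib-+ m (λ X → f (v Vector.∷ X)) (λ X → g (v Vector.∷ X))))
      (SumBits.distrib-+ n _ _)

  module SumStrings (m : ℕ) = IsSummation (sumStrings-isSummation m)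

  sumStrings-1 : ∀ m → sumStrings {n} m (λ _ → 1) ≡ (2 ^ n) ^ m
  sumStrings-1 zero    = refl
  sumStrings-1 (suc m) = begin
    sumBits n (λ _ → sumStrings m (λ _ → 1)) ≡⟨ SumBits.cong-≗ n (λ _ → sumStrings-1 m) ⟩
    sumBits n (λ _ → (2 ^ n) ^ m)           ≡⟨ SumBits.const n ((2 ^ n) ^ m) ⟩
    (2 ^ n) ^ m * sumBits n (λ _ → 1)       ≡⟨ cong ((2 ^ n) ^ m *_) (sumBits-1 n) ⟩
    (2 ^ n) ^ m * 2 ^ n                     ≡⟨ *-comm ((2 ^ n) ^ m) (2 ^ n) ⟩
    (2 ^ n) ^ suc m                         ∎
    where open ≡-Reasoning

  sumStrings-comm : ∀ m {A} {∑ : (A → ℕ) → ℕ} → IsSummation ∑ → (f : Strings n m → A → ℕ) →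
    sumStrings m (λ X → ∑ (f X)) ≡ ∑ (λ y → sumStrings m (λ X → f X y))
  sumStrings-comm zero    ∑-isSummation f = refl
  sumStrings-comm (suc m) ∑-isSummation f = trans
    (SumBits.cong-≗ n (λ v → sumStrings-comm m ∑-isSummation (λ X → f (v Vector.∷ X))))
    (sumBits-comm n ∑-isSummation (λ v y → sumStrings m (λ X → f (v Vector.∷ X) y)))

  sumStrings-box : ∀ m (G : Fin m → BitStr n → Bool) →
    sumStrings m (λ X → 𝟙 (all (λ i → G i (X i)))) ≡ product (λ i → sumBits n (𝟙 ∘ G i))
  sumStrings-box zero    G = refl
  sumStrings-box (suc m) G = begin
    sumBits n (λ v → sumStrings m (λ X → 𝟙 (G zero v ∧ all (λ i → G (suc i) (X i)))))
      ≡⟨ SumBits.cong-≗ n (λ v → SumStrings.cong-≗ m (λ X → 𝟙-∧ (G zero v) _)) ⟩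
    sumBits n (λ v → sumStrings m (λ X → 𝟙 (G zero v) * 𝟙 (all (λ i → G (suc i) (X i)))))
      ≡⟨ SumBits.cong-≗ n (λ v → SumStrings.*-distribˡ m (𝟙 (G zero v)) _) ⟩
    sumBits n (λ v → 𝟙 (G zero v) * sumStrings m (λ X → 𝟙 (all (λ i → G (suc i) (X i)))))
      ≡⟨ SumBits.cong-≗ n (λ v → cong (𝟙 (G zero v) *_) (sumStrings-box m (G ∘ suc))) ⟩
    sumBits n (λ v → 𝟙 (G zero v) * product (λ i → sumBits n (𝟙 ∘ G (suc i))))
      ≡⟨ SumBits.*-distribʳ n _ (𝟙 ∘ G zero) ⟩
    sumBits n (𝟙 ∘ G zero) * product (λ i → sumBits n (𝟙 ∘ G (suc i))) ∎
    where open ≡-Reasoning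

  sumStrings-fibres : ∀ m (w : Strings n m → ℕ) (h : BitStr n → ℕ) i →
    sumStrings m (λ X → w X * h (X i)) ≡
    sumBits n (λ u → sumStrings m (λ X → w X * 𝟙 (does (X i ≟ u))) * h u)
  sumStrings-fibres m w h i = begin
    sumStrings m (λ X → w X * h (X i))
      ≡⟨ SumStrings.cong-≗ m (λ X → cong (w X *_) (sumBits-δ n h (X i))) ⟨
    sumStrings m (λ X → w X * sumBits n (λ u → 𝟙 (does (X i ≟ u)) * h u))
      ≡⟨ SumStrings.cong-≗ m (λ X → SumBits.*-distribˡ n (w X) _) ⟨
    sumStrings m (λ X → sumBits n (λ u → w X * (𝟙 (does (X i ≟ u)) * h u)))
      ≡⟨ sumStrings-comm m (sumBits-isSummation n) _ ⟩
    sumBits n (λ u → sumStrings m (λ X → w X * (𝟙 (does (X i ≟ u)) * h u)))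
      ≡⟨ SumBits.cong-≗ n (λ u → SumStrings.cong-≗ m (λ X → *-assoc (w X) _ (h u))) ⟨
    sumBits n (λ u → sumStrings m (λ X → w X * 𝟙 (does (X i ≟ u)) * h u))
      ≡⟨ SumBits.cong-≗ n (λ u → SumStrings.*-distribʳ m (h u) _) ⟩
    sumBits n (λ u → sumStrings m (λ X → w X * 𝟙 (does (X i ≟ u))) * h u) ∎
    where open ≡-Reasoning

-- Rectangles and deterministic protocols

affine-bound-+ : ∀ α β {a₁ a₂ b₁ b₂ δ} → α * a₁ ≤ β * b₁ + δ → α * a₂ ≤ β * b₂ + δ →
  α * (a₁ + a₂) ≤ β * (b₁ + b₂) + 2 * δ
affine-bound-+ α β {a₁} {a₂} {b₁} {b₂} {δ} bound₁ bound₂ = begin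
  α * (a₁ + a₂)                ≡⟨ *-distribˡ-+ α a₁ a₂ ⟩
  α * a₁ + α * a₂              ≤⟨ +-mono-≤ bound₁ bound₂ ⟩
  (β * b₁ + δ) + (β * b₂ + δ)  ≡⟨ regroup β b₁ b₂ δ ⟩
  β * (b₁ + b₂) + 2 * δ        ∎
  where
  open ≤-Reasoning
  regroup : ∀ β b₁ b₂ δ → (β * b₁ + δ) + (β * b₂ + δ) ≡ β * (b₁ + b₂) + 2 * δ
  regroup = solve-∀

module Rectangles {I J : Set} {∑ᴵ : (I → ℕ) → ℕ} {∑ᴶ : (J → ℕ) → ℕ}
                  (∑ᴵ-isSummation : IsSummation ∑ᴵ) (∑ᴶ-isSummation : IsSummation ∑ᴶ) where

  private
    module ∑ᴵ = IsSummation ∑ᴵ-isSummation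
    module ∑ᴶ = IsSummation ∑ᴶ-isSummation

  mass : (I → J → ℕ) → (I → Bool) → (J → Bool) → ℕ
  mass H A B = ∑ᴵ (λ x → ∑ᴶ (λ y → 𝟙 (A x) * (𝟙 (B y) * H x y)))

  mass-const : ∀ c A B → mass (λ _ _ → c) A B ≡ ∑ᴵ (𝟙 ∘ A) * ∑ᴶ (𝟙 ∘ B) * c
  mass-const c A B = begin
    ∑ᴵ (λ x → ∑ᴶ (λ y → 𝟙 (A x) * (𝟙 (B y) * c)))
      ≡⟨ ∑ᴵ.cong-≗ (λ x → ∑ᴶ.*-distribˡ (𝟙 (A x)) _) ⟩
    ∑ᴵ (λ x → 𝟙 (A x) * ∑ᴶ (λ y → 𝟙 (B y) * c))
      ≡⟨ ∑ᴵ.cong-≗ (λ x → cong (𝟙 (A x) *_) (∑ᴶ.*-distribʳ c (𝟙 ∘ B))) ⟩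
    ∑ᴵ (λ x → 𝟙 (A x) * (∑ᴶ (𝟙 ∘ B) * c))
      ≡⟨ ∑ᴵ.*-distribʳ _ (𝟙 ∘ A) ⟩
    ∑ᴵ (𝟙 ∘ A) * (∑ᴶ (𝟙 ∘ B) * c)
      ≡⟨ *-assoc (∑ᴵ (𝟙 ∘ A)) _ c ⟨
    ∑ᴵ (𝟙 ∘ A) * ∑ᴶ (𝟙 ∘ B) * c ∎
    where open ≡-Reasoning

  mass-⊆ : ∀ {H H′} A′ B′ A B →
    (∀ x y → T (A′ x) → T (B′ y) → T (A x) × T (B y) × H x y ≡ H′ x y) →
    mass H A′ B′ ≤ mass H′ A B
  mass-⊆ A′ B′ A B inside =
    ∑ᴵ.mono-≤ (λ x → ∑ᴶ.mono-≤ (λ y → pointwise (A′ x) (B′ y) (A x) (B y) (inside x y)))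
    where
    pointwise : ∀ a′ b′ a b {h h′} → (T a′ → T b′ → T a × T b × h ≡ h′) →
      𝟙 a′ * (𝟙 b′ * h) ≤ 𝟙 a * (𝟙 b * h′)
    pointwise false b′    a     b     _      = z≤n
    pointwise true  false a     b     _      = z≤n
    pointwise true  true  true  true  inside with _ , _ , refl ← inside _ _ = ≤-refl
    pointwise true  true  false b     inside with () ← inside _ _
    pointwise true  true  true  false inside with _ , () , _ ← inside _ _

  module _ {O : Set} where

    along : ∀ {c} → (I → J → O → ℕ) → Protocol I J O c → I → J → ℕ
    along H π x y = H x y (run π x y)

    mass-alice : ∀ {c} H g (t f : Protocol I J O c) A B →
      mass (along H (alice g t f)) A B ≡
      mass (along H t) (λ x → A x ∧ g x) B + mass (along H f) (λ x → A x ∧ not (g x)) B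
    mass-alice H g t f A B = trans
      (∑ᴵ.cong-≗ (λ x → trans (∑ᴶ.cong-≗ (pointwise x)) (∑ᴶ.distrib-+ _ _)))
      (∑ᴵ.distrib-+ _ _)
      where
      pointwise : ∀ x y → 𝟙 (A x) * (𝟙 (B y) * along H (alice g t f) x y) ≡
        𝟙 (A x ∧ g x) * (𝟙 (B y) * along H t x y) + 𝟙 (A x ∧ not (g x)) * (𝟙 (B y) * along H f x y)
      pointwise x y with g x
      ... | true  = 𝟙-if (A x) true  _ _
      ... | false = 𝟙-if (A x) false _ _

    mass-bob : ∀ {c} H g (t f : Protocol I J O c) A B →
      mass (along H (bob g t f)) A B ≡
      mass (along H t) A (λ y → B y ∧ g y) + mass (along H f) A (λ y → B y ∧ not (g y))
    mass-bob H g t f A B = trans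
      (∑ᴵ.cong-≗ (λ x → trans (∑ᴶ.cong-≗ (pointwise x)) (∑ᴶ.distrib-+ _ _)))
      (∑ᴵ.distrib-+ _ _)
      where
      pointwise : ∀ x y → 𝟙 (A x) * (𝟙 (B y) * along H (bob g t f) x y) ≡
        𝟙 (A x) * (𝟙 (B y ∧ g y) * along H t x y) + 𝟙 (A x) * (𝟙 (B y ∧ not (g y)) * along H f x y)
      pointwise x y with g y
      ... | true  = trans (cong (𝟙 (A x) *_) (𝟙-if (B y) true  _ _)) (*-distribˡ-+ (𝟙 (A x)) _ _)
      ... | false = trans (cong (𝟙 (A x) *_) (𝟙-if (B y) false _ _)) (*-distribˡ-+ (𝟙 (A x)) _ _)

    protocol-bound : ∀ (H₁ H₂ : I → J → O → ℕ) (α β γ : ℕ) →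
      (∀ o A B → α * mass (λ x y → H₁ x y o) A B ≤ β * mass (λ x y → H₂ x y o) A B + γ) →
      ∀ {c} (π : Protocol I J O c) A B →
      α * mass (along H₁ π) A B ≤ β * mass (along H₂ π) A B + 2 ^ c * γ
    protocol-bound H₁ H₂ α β γ leaf-bound {c} (leaf o) A B =
      ≤-trans (leaf-bound o A B) (+-monoʳ-≤ _ (m≤n*m γ (2 ^ c) {{m^n≢0 2 c}}))
    protocol-bound H₁ H₂ α β γ leaf-bound {suc c} (alice g t f) A B = begin
      α * mass (along H₁ (alice g t f)) A B
        ≡⟨ cong (α *_) (mass-alice H₁ g t f A B) ⟩
      α * (mass (along H₁ t) Aᵗ B + mass (along H₁ f) Aᶠ B)
        ≤⟨ affine-bound-+ α β (protocol-bound H₁ H₂ α β γ leaf-bound t Aᵗ B)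
                              (protocol-bound H₁ H₂ α β γ leaf-bound f Aᶠ B) ⟩
      β * (mass (along H₂ t) Aᵗ B + mass (along H₂ f) Aᶠ B) + 2 * (2 ^ c * γ)
        ≡⟨ cong₂ _+_ (cong (β *_) (mass-alice H₂ g t f A B)) (*-assoc 2 (2 ^ c) γ) ⟨
      β * mass (along H₂ (alice g t f)) A B + 2 ^ suc c * γ ∎
      where
      open ≤-Reasoning
      Aᵗ Aᶠ : I → Bool
      Aᵗ x = A x ∧ g x
      Aᶠ x = A x ∧ not (g x)
    protocol-bound H₁ H₂ α β γ leaf-bound {suc c} (bob g t f) A B = begin
      α * mass (along H₁ (bob g t f)) A B
        ≡⟨ cong (α *_) (mass-bob H₁ g t f A B) ⟩
      α * (mass (along H₁ t) A Bᵗ + mass (along H₁ f) A Bᶠ)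
        ≤⟨ affine-bound-+ α β (protocol-bound H₁ H₂ α β γ leaf-bound t A Bᵗ)
                              (protocol-bound H₁ H₂ α β γ leaf-bound f A Bᶠ) ⟩
      β * (mass (along H₂ t) A Bᵗ + mass (along H₂ f) A Bᶠ) + 2 * (2 ^ c * γ)
        ≡⟨ cong₂ _+_ (cong (β *_) (mass-bob H₂ g t f A B)) (*-assoc 2 (2 ^ c) γ) ⟨
      β * mass (along H₂ (bob g t f)) A B + 2 ^ suc c * γ ∎
      where
      open ≤-Reasoning
      Bᵗ Bᶠ : J → Bool
      Bᵗ y = B y ∧ g y
      Bᶠ y = B y ∧ not (g y)

-- Large rectangles are fooled by every short list of candidates

module Fooling (n m : ℕ) (2m≤N : 2 * m ≤ 2 ^ n) where

  open Rectangles (sumStrings-isSummation {n} m) (sumStrings-isSummation {n} m) public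

  N : ℕ
  N = 2 ^ n

  N⁴ : ℕ
  N⁴ = N * N * (N * N)

  instance
    N≢0 : NonZero N
    N≢0 = m^n≢0 2 n
    N²≢0 : NonZero (N * N)
    N²≢0 = m*n≢0 N N
    N⁴≢0 : NonZero N⁴
    N⁴≢0 = m*n≢0 (N * N) (N * N)

  Family : Set
  Family = Strings n m → Bool

  ∣_∣ : Family → ℕ
  ∣ A ∣ = sumStrings m (𝟙 ∘ A)

  fibre : Family → Fin m → BitStr n → Family
  fibre A i u X = A X ∧ does (X i ≟ u)

  heavy : Family → Fin m → BitStr n → Bool
  heavy A i u = ⌊ ∣ A ∣ ≤? N * N * ∣ fibre A i u ∣ ⌋

  sparse : Family → Fin m → Bool
  sparse A i = ⌊ 2 * sumBits n (𝟙 ∘ heavy A i) ≤? N ⌋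

  #sparse : Family → ℕ
  #sparse A = ∑[ i < m ] 𝟙 (sparse A i)

  lightMass : Family → Fin m → ℕ
  lightMass A i = sumStrings m (λ X → 𝟙 (A X) * 𝟙 (not (heavy A i (X i))))

  lightMass-bound : ∀ A i → N * N * lightMass A i ≤ ∣ A ∣ * N
  lightMass-bound A i = begin
    N * N * lightMass A i
      ≡⟨ cong (N * N *_) (sumStrings-fibres m (𝟙 ∘ A) (𝟙 ∘ not ∘ heavy A i) i) ⟩
    N * N * sumBits n (λ u → fibreSize u * 𝟙 (not (heavy A i u)))
      ≡⟨ SumBits.*-distribˡ n (N * N) _ ⟨
    sumBits n (λ u → N * N * (fibreSize u * 𝟙 (not (heavy A i u))))
      ≤⟨ SumBits.mono-≤ n light ⟩
    sumBits n (λ _ → ∣ A ∣)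
      ≡⟨ SumBits.const n ∣ A ∣ ⟩
    ∣ A ∣ * sumBits n (λ _ → 1)
      ≡⟨ cong (∣ A ∣ *_) (sumBits-1 n) ⟩
    ∣ A ∣ * N ∎
    where
    open ≤-Reasoning
    fibreSize : BitStr n → ℕ
    fibreSize u = sumStrings m (λ X → 𝟙 (A X) * 𝟙 (does (X i ≟ u)))

    ∣fibre∣ : ∀ u → fibreSize u ≡ ∣ fibre A i u ∣
    ∣fibre∣ u = SumStrings.cong-≗ m (λ X → sym (𝟙-∧ (A X) _))

    below-threshold : ∀ s q c (s≤?qc : Dec (s ≤ q * c)) → q * (c * 𝟙 (not ⌊ s≤?qc ⌋)) ≤ s
    below-threshold s q c (yes _)   =
      ≤-trans (≤-reflexive (trans (cong (q *_) (*-zeroʳ c)) (*-zeroʳ q))) z≤n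
    below-threshold s q c (no s≰qc) =
      ≤-trans (≤-reflexive (cong (q *_) (*-identityʳ c))) (<⇒≤ (≰⇒> s≰qc))

    light : ∀ u → N * N * (fibreSize u * 𝟙 (not (heavy A i u))) ≤ ∣ A ∣
    light u rewrite ∣fibre∣ u =
      below-threshold (∣ A ∣) (N * N) (∣ fibre A i u ∣) (∣ A ∣ ≤? N * N * ∣ fibre A i u ∣)

  lightMass-total : ∀ A → 2 * ∑[ i < m ] lightMass A i ≤ ∣ A ∣
  lightMass-total A = *-cancelˡ-≤ (N * N) (begin
    N * N * (2 * L)                   ≡⟨ x*[2*y]≡2*[x*y] (N * N) L ⟩
    2 * (N * N * L)                   ≡⟨ cong (2 *_) (SumFin.*-distribˡ m (N * N) (lightMass A)) ⟨
    2 * ∑[ i < m ] (N * N * lightMass A i) ≤⟨ *-monoʳ-≤ 2 (SumFin.mono-≤ m (lightMass-bound A)) ⟩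
    2 * ∑[ i < m ] (∣ A ∣ * N)        ≡⟨ cong (2 *_) (SumFin.const m (∣ A ∣ * N)) ⟩
    2 * (∣ A ∣ * N * ∑[ i < m ] 1)    ≡⟨ cong (λ k → 2 * (∣ A ∣ * N * k)) (sum-1 m) ⟩
    2 * (∣ A ∣ * N * m)               ≡⟨ regroup ∣ A ∣ N m ⟩
    ∣ A ∣ * (2 * m) * N               ≤⟨ *-monoˡ-≤ N (*-monoʳ-≤ ∣ A ∣ 2m≤N) ⟩
    ∣ A ∣ * N * N                     ≡⟨ a*N*N≡N*N*a ∣ A ∣ N ⟩
    N * N * ∣ A ∣                     ∎)
    where
    open ≤-Reasoning
    L = ∑[ i < m ] lightMass A i
    x*[2*y]≡2*[x*y] : ∀ x y → x * (2 * y) ≡ 2 * (x * y)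
    x*[2*y]≡2*[x*y] = solve-∀
    a*N*N≡N*N*a : ∀ a N → a * N * N ≡ N * N * a
    a*N*N≡N*N*a = solve-∀
    regroup : ∀ a N m → 2 * (a * N * m) ≡ a * (2 * m) * N
    regroup = solve-∀

  allowed : Family → Fin m → BitStr n → Bool
  allowed A i u = not (sparse A i) ∨ heavy A i u

  box : Family → Family
  box A X = all (λ i → allowed A i (X i))

  size≤box+lightMass : ∀ A → ∣ A ∣ ≤ ∣ box A ∣ + ∑[ i < m ] lightMass A i
  size≤box+lightMass A = begin
    ∣ A ∣
      ≤⟨ SumStrings.mono-≤ m covered ⟩
    sumStrings m (λ X → 𝟙 (box A X) + ∑[ i < m ] (𝟙 (A X) * 𝟙 (not (heavy A i (X i)))))
      ≡⟨ SumStrings.distrib-+ m _ _ ⟩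
    ∣ box A ∣ + sumStrings m (λ X → ∑[ i < m ] (𝟙 (A X) * 𝟙 (not (heavy A i (X i)))))
      ≡⟨ cong (∣ box A ∣ +_) (sumStrings-comm m (sumFin-isSummation m) _) ⟩
    ∣ box A ∣ + ∑[ i < m ] lightMass A i ∎
    where
    open ≤-Reasoning
    𝟙-not-∨ : ∀ a b → 𝟙 (not (a ∨ b)) ≤ 1 * 𝟙 (not b)
    𝟙-not-∨ true  b     = z≤n
    𝟙-not-∨ false true  = z≤n
    𝟙-not-∨ false false = ≤-refl

    covered : ∀ X → 𝟙 (A X) ≤ 𝟙 (box A X) + ∑[ i < m ] (𝟙 (A X) * 𝟙 (not (heavy A i (X i))))
    covered X with A X
    ... | false = z≤n
    ... | true  = ≤-trans (𝟙-all-cover (λ i → allowed A i (X i)))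
      (+-monoʳ-≤ _ (SumFin.mono-≤ m (λ i → 𝟙-not-∨ (not (sparse A i)) (heavy A i (X i)))))

  size≤2*box : ∀ A → ∣ A ∣ ≤ 2 * ∣ box A ∣
  size≤2*box A = +-cancelʳ-≤ ∣ A ∣ ∣ A ∣ (2 * ∣ box A ∣) (begin
    ∣ A ∣ + ∣ A ∣                 ≡⟨ cong (∣ A ∣ +_) (+-identityʳ ∣ A ∣) ⟨
    2 * ∣ A ∣                     ≤⟨ *-monoʳ-≤ 2 (size≤box+lightMass A) ⟩
    2 * (∣ box A ∣ + L)           ≡⟨ *-distribˡ-+ 2 ∣ box A ∣ L ⟩
    2 * ∣ box A ∣ + 2 * L         ≤⟨ +-monoʳ-≤ (2 * ∣ box A ∣) (lightMass-total A) ⟩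
    2 * ∣ box A ∣ + ∣ A ∣         ∎)
    where
    open ≤-Reasoning
    L = ∑[ i < m ] lightMass A i

  box-bound : ∀ A → ∣ box A ∣ * 2 ^ #sparse A ≤ N ^ m
  box-bound A = begin
    ∣ box A ∣ * 2 ^ #sparse A
      ≡⟨ cong (_* 2 ^ #sparse A) (sumStrings-box m (allowed A)) ⟩
    product (λ i → sumBits n (𝟙 ∘ allowed A i)) * 2 ^ #sparse A
      ≤⟨ product-bound N _ (sparse A) allowed≤N sparse⇒2*allowed≤N ⟩
    N ^ m ∎
    where
    open ≤-Reasoning
    allowed≤N : ∀ i → sumBits n (𝟙 ∘ allowed A i) ≤ N
    allowed≤N i = ≤-trans (SumBits.indicator≤ n (allowed A i)) (≤-reflexive (sumBits-1 n))

    sparse⇒2*allowed≤N : ∀ i → T (sparse A i) → 2 * sumBits n (𝟙 ∘ allowed A i) ≤ N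
    sparse⇒2*allowed≤N i sparseᵢ = subst (λ h → 2 * h ≤ N)
      (SumBits.cong-≗ n (λ u → cong (λ b → 𝟙 (not b ∨ heavy A i u)) (sym (Equivalence.to T-≡ sparseᵢ))))
      (toWitness sparseᵢ)

  Λ : ℕ
  Λ = 2 * N ^ m

  size-sparse-bound : ∀ A → ∣ A ∣ * 2 ^ #sparse A ≤ Λ
  size-sparse-bound A = begin
    ∣ A ∣ * 2 ^ #sparse A             ≤⟨ *-monoˡ-≤ (2 ^ #sparse A) (size≤2*box A) ⟩
    2 * ∣ box A ∣ * 2 ^ #sparse A     ≡⟨ *-assoc 2 ∣ box A ∣ _ ⟩
    2 * (∣ box A ∣ * 2 ^ #sparse A)   ≤⟨ *-monoʳ-≤ 2 (box-bound A) ⟩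
    Λ                                 ∎
    where open ≤-Reasoning

  ∃-dense-coordinate : ∀ A B → Λ * Λ < ∣ A ∣ * ∣ B ∣ * 2 ^ m →
    ∃ λ i → ¬ T (sparse A i) × ¬ T (sparse B i)
  ∃-dense-coordinate A B large = ∃-neither (sparse A) (sparse B) (≰⇒> few-sparse)
    where
    open ≤-Reasoning
    few-sparse : ¬ m ≤ #sparse A + #sparse B
    few-sparse m≤#sparse = <⇒≱ large (begin
      ∣ A ∣ * ∣ B ∣ * 2 ^ m
        ≤⟨ *-monoʳ-≤ (∣ A ∣ * ∣ B ∣) (^-monoʳ-≤ 2 m≤#sparse) ⟩
      ∣ A ∣ * ∣ B ∣ * 2 ^ (#sparse A + #sparse B)
        ≡⟨ cong (∣ A ∣ * ∣ B ∣ *_) (^-distribˡ-+-* 2 (#sparse A) (#sparse B)) ⟩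
      ∣ A ∣ * ∣ B ∣ * (2 ^ #sparse A * 2 ^ #sparse B)
        ≡⟨ *-interchange ∣ A ∣ ∣ B ∣ (2 ^ #sparse A) (2 ^ #sparse B) ⟩
      ∣ A ∣ * 2 ^ #sparse A * (∣ B ∣ * 2 ^ #sparse B)
        ≤⟨ *-mono-≤ (size-sparse-bound A) (size-sparse-bound B) ⟩
      Λ * Λ ∎)

  ∃-heavy-pair : ∀ A B i → ¬ T (sparse A i) → ¬ T (sparse B i) → ∀ s →
    ∃ λ u → T (heavy A i u) × T (heavy B i (u ⊕ s))
  ∃-heavy-pair A B i denseA denseB s =
    let u , 1<heavyᵤ = sumBits-<⇒∃< n (λ _ → 1) (λ u → 𝟙 (heavy A i u) + 𝟙 (heavy B i (u ⊕ s))) N<heavy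
    in  u , 1<𝟙+𝟙⇒T×T (heavy A i u) (heavy B i (u ⊕ s)) 1<heavyᵤ
    where
    open ≤-Reasoning
    #heavy : Family → ℕ
    #heavy C = sumBits n (𝟙 ∘ heavy C i)

    dense⇒N<2*#heavy : ∀ C → ¬ T (sparse C i) → N < 2 * #heavy C
    dense⇒N<2*#heavy C denseC = ≰⇒> (denseC ∘ fromWitness)

    N<heavy : sumBits n (λ _ → 1) < sumBits n (λ u → 𝟙 (heavy A i u) + 𝟙 (heavy B i (u ⊕ s)))
    N<heavy = begin-strict
      sumBits n (λ _ → 1)         ≡⟨ sumBits-1 n ⟩
      N                           <⟨ *-cancelˡ-< 2 N _ 2N<2*#heavy ⟩
      #heavy A + #heavy B         ≡⟨ cong (#heavy A +_) (sumBits-⊕ n (𝟙 ∘ heavy B i) s) ⟨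
      #heavy A + sumBits n (λ u → 𝟙 (heavy B i (u ⊕ s)))
                                  ≡⟨ SumBits.distrib-+ n _ _ ⟨
      sumBits n (λ u → 𝟙 (heavy A i u) + 𝟙 (heavy B i (u ⊕ s))) ∎
      where
      2N<2*#heavy : 2 * N < 2 * (#heavy A + #heavy B)
      2N<2*#heavy = begin-strict
        2 * N                       ≡⟨ cong (N +_) (+-identityʳ N) ⟩
        N + N                       <⟨ +-mono-< (dense⇒N<2*#heavy A denseA) (dense⇒N<2*#heavy B denseB) ⟩
        2 * #heavy A + 2 * #heavy B ≡⟨ *-distribˡ-+ 2 (#heavy A) (#heavy B) ⟨
        2 * (#heavy A + #heavy B)   ∎

  fibres-shrink : ∀ A B i u v → T (heavy A i u) → T (heavy B i v) →
    ∣ A ∣ * ∣ B ∣ ≤ N⁴ * (∣ fibre A i u ∣ * ∣ fibre B i v ∣)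
  fibres-shrink A B i u v heavyA heavyB = begin
    ∣ A ∣ * ∣ B ∣
      ≤⟨ *-mono-≤ (toWitness heavyA) (toWitness heavyB) ⟩
    N * N * ∣ fibre A i u ∣ * (N * N * ∣ fibre B i v ∣)
      ≡⟨ *-interchange (N * N) _ (N * N) _ ⟩
    N⁴ * (∣ fibre A i u ∣ * ∣ fibre B i v ∣) ∎
    where open ≤-Reasoning

  fibres-avoid : ∀ A B i u s X Y → T (fibre A i u X) → T (fibre B i (u ⊕ s) Y) →
    T (A X) × T (B Y) × ¬ IsSolution X Y s
  fibres-avoid A B i u s X Y X∈A′ Y∈B′ = A∋X , B∋Y , ¬solution
    where
    A∋X = proj₁ (Equivalence.to T-∧ X∈A′)
    B∋Y = proj₁ (Equivalence.to T-∧ Y∈B′)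
    Xᵢ≡u = T-does⇒ (X i ≟ u) (proj₂ (Equivalence.to T-∧ X∈A′))
    Yᵢ≡u⊕s = T-does⇒ (Y i ≟ u ⊕ s) (proj₂ (Equivalence.to T-∧ Y∈B′))
    ¬solution : ¬ IsSolution X Y s
    ¬solution solution = solution i i (sym (trans (cong₂ _⊕_ Xᵢ≡u Yᵢ≡u⊕s) (⊕-cancelˡ u s)))

  ∃-avoiding-subrectangle : ∀ A B s → Λ * Λ < ∣ A ∣ * ∣ B ∣ * 2 ^ m →
    ∃₂ λ A′ B′ → ∣ A ∣ * ∣ B ∣ ≤ N⁴ * (∣ A′ ∣ * ∣ B′ ∣) ×
                 (∀ X Y → T (A′ X) → T (B′ Y) → T (A X) × T (B Y) × ¬ IsSolution X Y s)
  ∃-avoiding-subrectangle A B s large =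
    let i , denseA , denseB = ∃-dense-coordinate A B large
        u , heavyA , heavyB = ∃-heavy-pair A B i denseA denseB s
    in  fibre A i u , fibre B i (u ⊕ s) ,
        fibres-shrink A B i u (u ⊕ s) heavyA heavyB , fibres-avoid A B i u s

  misses : ∀ {j} → Vec (BitStr n) j → Strings n m → Strings n m → ℕ
  misses L X Y = 𝟙 (not (does (any? (isSolution? X Y) L)))

  misses-∷ : ∀ {j} (L : Vec (BitStr n) j) s X Y → ¬ IsSolution X Y s →
    misses L X Y ≡ misses (s ∷ L) X Y
  misses-∷ L s X Y ¬solution = cong (𝟙 ∘ not)
    (does-⇔ (mk⇔ there dropHead) (any? (isSolution? X Y) L) (any? (isSolution? X Y) (s ∷ L)))
    where
    dropHead : Any (IsSolution X Y) (s ∷ L) → Any (IsSolution X Y) L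
    dropHead (here solution) = ⊥-elim (¬solution solution)
    dropHead (there p)       = p

  large-restricts : ∀ {j a a′} → a ≤ N⁴ * a′ →
    Λ * Λ * N⁴ ^ suc j < a * 2 ^ m → Λ * Λ * N⁴ ^ j < a′ * 2 ^ m
  large-restricts {j} {a} {a′} a≤N⁴a′ large = *-cancelˡ-< N⁴ _ _ (begin-strict
    N⁴ * (Λ * Λ * N⁴ ^ j)    ≡⟨ x*[y*z]≡y*[x*z] N⁴ (Λ * Λ) (N⁴ ^ j) ⟩
    Λ * Λ * N⁴ ^ suc j       <⟨ large ⟩
    a * 2 ^ m                ≤⟨ *-monoˡ-≤ (2 ^ m) a≤N⁴a′ ⟩
    N⁴ * a′ * 2 ^ m          ≡⟨ *-assoc N⁴ a′ (2 ^ m) ⟩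
    N⁴ * (a′ * 2 ^ m)        ∎)
    where
    open ≤-Reasoning
    x*[y*z]≡y*[x*z] : ∀ x y z → x * (y * z) ≡ y * (x * z)
    x*[y*z]≡y*[x*z] = solve-∀

  mass-misses-∷ : ∀ {j} (L : Vec (BitStr n) j) s A B A′ B′ →
    (∀ X Y → T (A′ X) → T (B′ Y) → T (A X) × T (B Y) × ¬ IsSolution X Y s) →
    mass (misses L) A′ B′ ≤ mass (misses (s ∷ L)) A B
  mass-misses-∷ L s A B A′ B′ avoids = mass-⊆ A′ B′ A B λ X Y X∈A′ Y∈B′ →
    let A∋X , B∋Y , ¬solution = avoids X Y X∈A′ Y∈B′
    in  A∋X , B∋Y , misses-∷ L s X Y ¬solution

  fooling : ∀ {j} (L : Vec (BitStr n) j) A B → Λ * Λ * N⁴ ^ j < ∣ A ∣ * ∣ B ∣ * 2 ^ m →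
    ∣ A ∣ * ∣ B ∣ ≤ N⁴ ^ j * mass (misses L) A B
  fooling [] A B _ =
    ≤-reflexive (sym (trans (*-identityˡ _) (trans (mass-const 1 A B) (*-identityʳ _))))
  fooling {suc j} (s ∷ L) A B large =
    let A′ , B′ , shrink , avoids = ∃-avoiding-subrectangle A B s large₀
    in  begin
    ∣ A ∣ * ∣ B ∣
      ≤⟨ shrink ⟩
    N⁴ * (∣ A′ ∣ * ∣ B′ ∣)
      ≤⟨ *-monoʳ-≤ N⁴ (fooling L A′ B′ (large-restricts {j} shrink large)) ⟩
    N⁴ * (N⁴ ^ j * mass (misses L) A′ B′)
      ≤⟨ *-monoʳ-≤ N⁴ (*-monoʳ-≤ (N⁴ ^ j) (mass-misses-∷ L s A B A′ B′ avoids)) ⟩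
    N⁴ * (N⁴ ^ j * mass (misses (s ∷ L)) A B)
      ≡⟨ *-assoc N⁴ (N⁴ ^ j) _ ⟨
    N⁴ ^ suc j * mass (misses (s ∷ L)) A B ∎
    where
    open ≤-Reasoning
    large₀ : Λ * Λ < ∣ A ∣ * ∣ B ∣ * 2 ^ m
    large₀ = ≤-<-trans (m≤m*n (Λ * Λ) (N⁴ ^ suc j) {{m^n≢0 N⁴ (suc j)}}) large

-- PostBPP list-solvers

2^-reflects-≤ : ∀ {a b} → 2 ^ a ≤ 2 ^ b → a ≤ b
2^-reflects-≤ 2ᵃ≤2ᵇ = ≮⇒≥ (λ b<a → <⇒≱ (^-monoʳ-< 2 (s≤s (s≤s z≤n)) b<a) 2ᵃ≤2ᵇ)

module ListSolverBound (n m k : ℕ) (2m≤N : 2 * m ≤ 2 ^ n) where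

  open Fooling n m 2m≤N

  Output : Set
  Output = Maybe (Vec (BitStr n) k)

  accepts : Strings n m → Strings n m → Output → ℕ
  accepts _ _ o = 𝟙 (does (accepted? o))

  succeeds : Strings n m → Strings n m → Output → ℕ
  succeeds X Y o = 𝟙 (does (succeeds? X Y o))

  fails : Strings n m → Strings n m → Output → ℕ
  fails X Y nothing  = 0
  fails X Y (just L) = misses L X Y

  accepts≡succeeds+fails : ∀ X Y o → accepts X Y o ≡ succeeds X Y o + fails X Y o
  accepts≡succeeds+fails X Y nothing  = refl
  accepts≡succeeds+fails X Y (just L) = sym (𝟙-not (does (any? (isSolution? X Y) L)))

  threshold : ℕ
  threshold = Λ * Λ * N⁴ ^ k

  leaf-bound : ∀ b → 2 * N⁴ ^ k ≤ b → ∀ o A B →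
    2 ^ m * 2 * mass (λ X Y → accepts X Y o) A B ≤
    2 ^ m * b * mass (λ X Y → fails X Y o) A B + 2 * threshold
  leaf-bound b 2N⁴ᵏ≤b nothing  A B = ≤-trans (≤-reflexive nothing-accepted) z≤n
    where
    nothing-accepted : 2 ^ m * 2 * mass (λ _ _ → 0) A B ≡ 0
    nothing-accepted = trans (cong (2 ^ m * 2 *_) (trans (mass-const 0 A B) (*-zeroʳ (∣ A ∣ * ∣ B ∣))))
                             (*-zeroʳ (2 ^ m * 2))
  leaf-bound b 2N⁴ᵏ≤b (just L) A B with threshold <? ∣ A ∣ * ∣ B ∣ * 2 ^ m
  ... | yes large = begin
    2 ^ m * 2 * mass (λ _ _ → 1) A B      ≡⟨ cong (2 ^ m * 2 *_) (trans (mass-const 1 A B) (*-identityʳ _)) ⟩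
    2 ^ m * 2 * (∣ A ∣ * ∣ B ∣)           ≤⟨ *-monoʳ-≤ (2 ^ m * 2) (fooling L A B large) ⟩
    2 ^ m * 2 * (N⁴ ^ k * F)              ≡⟨ regroup (2 ^ m) (N⁴ ^ k) F ⟩
    2 ^ m * (2 * N⁴ ^ k) * F              ≤⟨ *-monoˡ-≤ F (*-monoʳ-≤ (2 ^ m) 2N⁴ᵏ≤b) ⟩
    2 ^ m * b * F                         ≤⟨ m≤m+n (2 ^ m * b * F) (2 * threshold) ⟩
    2 ^ m * b * F + 2 * threshold         ∎
    where
    open ≤-Reasoning
    F = mass (misses L) A B
    regroup : ∀ x y z → x * 2 * (y * z) ≡ x * (2 * y) * z
    regroup = solve-∀
  ... | no  ¬large = begin
    2 ^ m * 2 * mass (λ _ _ → 1) A B      ≡⟨ cong (2 ^ m * 2 *_) (trans (mass-const 1 A B) (*-identityʳ _)) ⟩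
    2 ^ m * 2 * (∣ A ∣ * ∣ B ∣)           ≡⟨ regroup (2 ^ m) (∣ A ∣ * ∣ B ∣) ⟩
    2 * (∣ A ∣ * ∣ B ∣ * 2 ^ m)           ≤⟨ *-monoʳ-≤ 2 (≮⇒≥ ¬large) ⟩
    2 * threshold                         ≤⟨ m≤n+m (2 * threshold) (2 ^ m * b * mass (misses L) A B) ⟩
    2 ^ m * b * mass (misses L) A B + 2 * threshold ∎
    where
    open ≤-Reasoning
    regroup : ∀ x y → x * 2 * y ≡ 2 * (y * x)
    regroup = solve-∀

  N⁴ᵏ≡2^[4nk] : N⁴ ^ k ≡ 2 ^ (4 * n * k)
  N⁴ᵏ≡2^[4nk] = begin
    N⁴ ^ k                ≡⟨ cong (_^ k) (x*x*[x*x]≡x^4 N) ⟩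
    (N ^ 4) ^ k           ≡⟨ cong (_^ k) (^-*-assoc 2 n 4) ⟩
    (2 ^ (n * 4)) ^ k     ≡⟨ ^-*-assoc 2 (n * 4) k ⟩
    2 ^ (n * 4 * k)       ≡⟨ cong (λ e → 2 ^ (e * k)) (*-comm n 4) ⟩
    2 ^ (4 * n * k)       ∎
    where
    open ≡-Reasoning
    x*x*[x*x]≡x^4 : ∀ x → x * x * (x * x) ≡ x * (x * (x * (x * 1)))
    x*x*[x*x]≡x^4 = solve-∀

  2N⁴ᵏ≤2^[5nk] : 1 ≤ n * k → 2 * N⁴ ^ k ≤ 2 ^ (5 * n * k)
  2N⁴ᵏ≤2^[5nk] 1≤nk = begin
    2 * N⁴ ^ k                      ≤⟨ *-mono-≤ (^-monoʳ-≤ 2 1≤nk) (≤-reflexive N⁴ᵏ≡2^[4nk]) ⟩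
    2 ^ (n * k) * 2 ^ (4 * n * k)   ≡⟨ ^-distribˡ-+-* 2 (n * k) (4 * n * k) ⟨
    2 ^ (n * k + 4 * n * k)         ≡⟨ cong (2 ^_) (*-distribʳ-+ k n (4 * n)) ⟨
    2 ^ (5 * n * k)                 ∎
    where open ≤-Reasoning

  module _ (Q : PostBPPListSolver n m k) (b : ℕ) (2N⁴ᵏ≤b : 2 * N⁴ ^ k ≤ b) (solves : ListSolves Q 1 b) where

    open PostBPPListSolver Q

    countSeeds : (Strings n m → Strings n m → Output → ℕ) → Strings n m → Strings n m → ℕ
    countSeeds H X Y = sumBits seedLen (λ r → H X Y (run (Π r) X Y))

    total : (Strings n m → Strings n m → Output → ℕ) → ℕ
    total H = sumStrings m (λ X → sumStrings m (countSeeds H X))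

    everything : Family
    everything _ = true

    smallMass : ℕ
    smallMass = 2 ^ commLen * (2 * threshold) * 2 ^ seedLen

    sum-mass≡total : ∀ H → sumBits seedLen (λ r → mass (along H (Π r)) everything everything) ≡ total H
    sum-mass≡total H = begin
      sumBits seedLen (λ r → sumStrings m (λ X → sumStrings m (λ Y → 1 * (1 * H X Y (run (Π r) X Y)))))
        ≡⟨ sumBits-comm seedLen (sumStrings-isSummation m) _ ⟩
      sumStrings m (λ X → sumBits seedLen (λ r → sumStrings m (λ Y → 1 * (1 * H X Y (run (Π r) X Y)))))
        ≡⟨ SumStrings.cong-≗ m (λ X → sumBits-comm seedLen (sumStrings-isSummation m) _) ⟩
      sumStrings m (λ X → sumStrings m (λ Y → sumBits seedLen (λ r → 1 * (1 * H X Y (run (Π r) X Y)))))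
        ≡⟨ SumStrings.cong-≗ m (λ X → SumStrings.cong-≗ m (λ Y → SumBits.cong-≗ seedLen (λ r →
             trans (*-identityˡ _) (*-identityˡ _)))) ⟩
      total H ∎
      where open ≡-Reasoning

    acceptCount≡ : ∀ X Y → acceptCount Q X Y ≡ countSeeds accepts X Y
    acceptCount≡ X Y = count≡sumBits seedLen _ _

    accept-split : ∀ X Y → countSeeds accepts X Y ≡ countSeeds succeeds X Y + countSeeds fails X Y
    accept-split X Y = trans (SumBits.cong-≗ seedLen (λ r → accepts≡succeeds+fails X Y (run (Π r) X Y)))
                             (SumBits.distrib-+ seedLen _ _)

    fails-rare : ∀ X Y → b * countSeeds fails X Y ≤ countSeeds accepts X Y
    fails-rare X Y = +-cancelˡ-≤ (b * countSeeds succeeds X Y) _ _ (begin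
      b * countSeeds succeeds X Y + b * countSeeds fails X Y ≡⟨ *-distribˡ-+ b _ _ ⟨
      b * (countSeeds succeeds X Y + countSeeds fails X Y)   ≡⟨ cong (b *_) (accept-split X Y) ⟨
      b * countSeeds accepts X Y                              ≡⟨ cong (b *_) (acceptCount≡ X Y) ⟨
      b * acceptCount Q X Y                                  ≤⟨ proj₂ (solves X Y) ⟩
      b * successCount Q X Y + 1 * acceptCount Q X Y
        ≡⟨ cong₂ (λ s a → b * s + a) (count≡sumBits seedLen _ _) (trans (*-identityˡ _) (acceptCount≡ X Y)) ⟩
      b * countSeeds succeeds X Y + countSeeds accepts X Y   ∎)
      where open ≤-Reasoning

    total-fails-rare : b * total fails ≤ total accepts
    total-fails-rare = begin
      b * total fails
        ≡⟨ SumStrings.*-distribˡ m b _ ⟨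
      sumStrings m (λ X → b * sumStrings m (countSeeds fails X))
        ≡⟨ SumStrings.cong-≗ m (λ X → SumStrings.*-distribˡ m b _) ⟨
      sumStrings m (λ X → sumStrings m (λ Y → b * countSeeds fails X Y))
        ≤⟨ SumStrings.mono-≤ m (λ X → SumStrings.mono-≤ m (fails-rare X)) ⟩
      total accepts ∎
      where open ≤-Reasoning

    total-accepts-large : N ^ m * N ^ m ≤ total accepts
    total-accepts-large = begin
      N ^ m * N ^ m
        ≡⟨ cong (_* N ^ m) (sumStrings-1 m) ⟨
      sumStrings m (λ _ → 1) * N ^ m
        ≡⟨ SumStrings.*-distribʳ m (N ^ m) (λ _ → 1) ⟨
      sumStrings m (λ _ → 1 * N ^ m)
        ≡⟨ SumStrings.cong-≗ m (λ _ → trans (*-identityˡ (N ^ m)) (sym (sumStrings-1 m))) ⟩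
      sumStrings m (λ _ → sumStrings m (λ _ → 1))
        ≤⟨ SumStrings.mono-≤ m (λ X → SumStrings.mono-≤ m (λ Y →
             subst (1 ≤_) (acceptCount≡ X Y) (proj₁ (solves X Y)))) ⟩
      total accepts ∎
      where open ≤-Reasoning

    protocols-bound : 2 ^ m * 2 * total accepts ≤ 2 ^ m * b * total fails + smallMass
    protocols-bound = begin
      2 ^ m * 2 * total accepts
        ≡⟨ cong (2 ^ m * 2 *_) (sum-mass≡total accepts) ⟨
      2 ^ m * 2 * sumBits seedLen (λ r → mass (along accepts (Π r)) everything everything)
        ≡⟨ SumBits.*-distribˡ seedLen (2 ^ m * 2) _ ⟨
      sumBits seedLen (λ r → 2 ^ m * 2 * mass (along accepts (Π r)) everything everything)
        ≤⟨ SumBits.mono-≤ seedLen (λ r → protocol-bound accepts fails (2 ^ m * 2) (2 ^ m * b)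
             (2 * threshold) (leaf-bound b 2N⁴ᵏ≤b) (Π r) everything everything) ⟩
      sumBits seedLen (λ r → 2 ^ m * b * mass (along fails (Π r)) everything everything + leafError)
        ≡⟨ SumBits.distrib-+ seedLen _ _ ⟩
      sumBits seedLen (λ r → 2 ^ m * b * mass (along fails (Π r)) everything everything)
        + sumBits seedLen (λ _ → leafError)
        ≡⟨ cong₂ _+_ (trans (SumBits.*-distribˡ seedLen (2 ^ m * b) _)
                            (cong (2 ^ m * b *_) (sum-mass≡total fails)))
                     (trans (SumBits.const seedLen leafError) (cong (leafError *_) (sumBits-1 seedLen))) ⟩
      2 ^ m * b * total fails + smallMass ∎
      where
      open ≤-Reasoning
      leafError = 2 ^ commLen * (2 * threshold)

    seeds-bound : 2 ^ m * (N ^ m * N ^ m) ≤ smallMass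
    seeds-bound = ≤-trans (*-monoʳ-≤ (2 ^ m) total-accepts-large)
                          (+-cancelˡ-≤ (2 ^ m * total accepts) _ _ (begin
      2 ^ m * total accepts + 2 ^ m * total accepts ≡⟨ x*y+x*y≡x*2*y (2 ^ m) (total accepts) ⟩
      2 ^ m * 2 * total accepts                     ≤⟨ protocols-bound ⟩
      2 ^ m * b * total fails + smallMass           ≡⟨ cong (_+ smallMass) (*-assoc (2 ^ m) b (total fails)) ⟩
      2 ^ m * (b * total fails) + smallMass         ≤⟨ +-monoˡ-≤ smallMass (*-monoʳ-≤ (2 ^ m) total-fails-rare) ⟩
      2 ^ m * total accepts + smallMass             ∎))
      where
      open ≤-Reasoning
      x*y+x*y≡x*2*y : ∀ x y → x * y + x * y ≡ x * 2 * y
      x*y+x*y≡x*2*y = solve-∀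

    complexity-bound : m ≤ complexity + 3 + 4 * n * k
    complexity-bound = 2^-reflects-≤ (*-cancelʳ-≤ (2 ^ m) _ (N ^ m * N ^ m) {{Nᵐ*Nᵐ≢0}} (begin
      2 ^ m * (N ^ m * N ^ m)
        ≤⟨ seeds-bound ⟩
      smallMass
        ≡⟨ regroup (2 ^ commLen) (2 ^ seedLen) (N ^ m) (N⁴ ^ k) ⟩
      2 ^ seedLen * 2 ^ commLen * 8 * N⁴ ^ k * (N ^ m * N ^ m)
        ≡⟨ cong (_* (N ^ m * N ^ m)) 2ˢ2ᶜ8N⁴ᵏ≡2^[…] ⟩
      2 ^ (complexity + 3 + 4 * n * k) * (N ^ m * N ^ m) ∎))
      where
      open ≤-Reasoning
      Nᵐ*Nᵐ≢0 : NonZero (N ^ m * N ^ m)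
      Nᵐ*Nᵐ≢0 = m*n≢0 (N ^ m) (N ^ m) {{m^n≢0 N m}} {{m^n≢0 N m}}

      regroup : ∀ c s x p → c * (2 * (2 * x * (2 * x) * p)) * s ≡ s * c * 8 * p * (x * x)
      regroup = solve-∀

      2ˢ2ᶜ8N⁴ᵏ≡2^[…] : 2 ^ seedLen * 2 ^ commLen * 8 * N⁴ ^ k ≡ 2 ^ (complexity + 3 + 4 * n * k)
      2ˢ2ᶜ8N⁴ᵏ≡2^[…] = sym (begin-equality
        2 ^ (seedLen + commLen + 3 + 4 * n * k)
          ≡⟨ ^-distribˡ-+-* 2 (seedLen + commLen + 3) (4 * n * k) ⟩
        2 ^ (seedLen + commLen + 3) * 2 ^ (4 * n * k)
          ≡⟨ cong (_* 2 ^ (4 * n * k)) (^-distribˡ-+-* 2 (seedLen + commLen) 3) ⟩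
        2 ^ (seedLen + commLen) * 8 * 2 ^ (4 * n * k)
          ≡⟨ cong (λ x → x * 8 * 2 ^ (4 * n * k)) (^-distribˡ-+-* 2 seedLen commLen) ⟩
        2 ^ seedLen * 2 ^ commLen * 8 * 2 ^ (4 * n * k)
          ≡⟨ cong (2 ^ seedLen * 2 ^ commLen * 8 *_) N⁴ᵏ≡2^[4nk] ⟨
        2 ^ seedLen * 2 ^ commLen * 8 * N⁴ ^ k ∎)

2m≤2ⁿ : ∀ n m → 1 ≤ m → m * m < 2 ^ n → 2 * m ≤ 2 ^ n
2m≤2ⁿ n (suc x) _ m²<2ⁿ =
  ≤-trans (≤-trans (m≤m+n (2 * suc x) (x * x)) (≤-reflexive (2m+[m-1]²≡m²+1 x))) m²<2ⁿ
  where
  2m+[m-1]²≡m²+1 : ∀ x → 2 * suc x + x * x ≡ suc (suc x * suc x)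
  2m+[m-1]²≡m²+1 = solve-∀

linear-from-logarithmic : ∀ {m C t} → m ≤ C + 3 + t → 5 * t ≤ m → 5 ≤ m → m ≤ 5 * C
linear-from-logarithmic {m} {C} {t} m≤C+3+t 5t≤m 5≤m = +-cancelʳ-≤ 15 m (5 * C) (begin
  m + 15          ≤⟨ +-monoʳ-≤ m (*-monoʳ-≤ 3 5≤m) ⟩
  m + 3 * m       ≡⟨ m+3m≡4m m ⟩
  4 * m           ≤⟨ +-cancelʳ-≤ m (4 * m) (5 * C + 15) 4m+m≤5C+15+m ⟩
  5 * C + 15      ∎)
  where
  open ≤-Reasoning
  m+3m≡4m : ∀ m → m + 3 * m ≡ 4 * m
  m+3m≡4m = solve-∀
  5[C+3+t]≡5C+15+5t : ∀ C t → 5 * (C + 3 + t) ≡ 5 * C + 15 + 5 * t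
  5[C+3+t]≡5C+15+5t = solve-∀
  4m+m≡5m : ∀ m → 4 * m + m ≡ 5 * m
  4m+m≡5m = solve-∀
  4m+m≤5C+15+m : 4 * m + m ≤ 5 * C + 15 + m
  4m+m≤5C+15+m = begin
    4 * m + m              ≡⟨ 4m+m≡5m m ⟩
    5 * m                  ≤⟨ *-monoʳ-≤ 5 m≤C+3+t ⟩
    5 * (C + 3 + t)        ≡⟨ 5[C+3+t]≡5C+15+5t C t ⟩
    5 * C + 15 + 5 * t     ≤⟨ +-monoʳ-≤ (5 * C + 15) 5t≤m ⟩
    5 * C + 15 + m         ∎

m≤5*complexity : (n m k : ℕ) → 1 ≤ n → 1 ≤ m → m * m < 2 ^ n → 1 ≤ k → 20 * n * k ≤ m →
  (Q : PostBPPListSolver n m k) → ListSolves Q 1 (2 ^ (5 * n * k)) → m ≤ 5 * PostBPPListSolver.complexity Q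
m≤5*complexity n m k 1≤n 1≤m m²<2ⁿ 1≤k 20nk≤m Q solves =
  linear-from-logarithmic {C = PostBPPListSolver.complexity Q} {t = 4 * n * k}
    (complexity-bound Q (2 ^ (5 * n * k)) (2N⁴ᵏ≤2^[5nk] 1≤nk) solves) 5[4nk]≤m 5≤m
  where
  open ListSolverBound n m k (2m≤2ⁿ n m 1≤m m²<2ⁿ)
  1≤nk : 1 ≤ n * k
  1≤nk = *-mono-≤ 1≤n 1≤k
  20nk≡5[4nk] : ∀ n k → 5 * (4 * n * k) ≡ 20 * n * k
  20nk≡5[4nk] = solve-∀
  5[4nk]≤m : 5 * (4 * n * k) ≤ m
  5[4nk]≤m = ≤-trans (≤-reflexive (20nk≡5[4nk] n k)) 20nk≤m
  5≤m : 5 ≤ m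
  5≤m = ≤-trans (*-monoʳ-≤ 5 (*-mono-≤ (*-mono-≤ {1} {4} (s≤s z≤n) 1≤n) 1≤k)) 5[4nk]≤m

lemma3p7 : Σ ℕ λ d → (1 ≤ d) ×
    ((n m k : ℕ) → 1 ≤ n → 1 ≤ m → m * m < 2 ^ n → 1 ≤ k → 20 * n * k ≤ m →
      (Q : PostBPPListSolver n m k) →
      ListSolves Q 1 (2 ^ (5 * n * k)) →
      m ≤ d * PostBPPListSolver.complexity Q)
lemma3p7 = 5 , s≤s z≤n , m≤5*complexity
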